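{- Let $G$ be a finite $2$-transitive permutation group with a regular normal subgroup $N$ and point stabilizer $H$. Then for $h\in H$, the coset $Nh$ contains a derangement if and only if $h$ centralizes a nonidentity element of $N$.
   Context: A derangement is an element with no fixed point. -}

module Defs where

open import Data.Nat using (ℕ)
open import Data.Fin using (Fin)
open import Data.Fin.Permutation using (Permutation′; _⟨$⟩ʳ_; _≈_; id; flip; _∘ₚ_)
open import Data.Product using (Σ; _×_; _,_; ∃)
open import Relation.Binary.PropositionalEquality using (_≡_; _≢_)
open import Relation.Nullary using (¬_)

PermSet : ℕ → Set₁
PermSet n = Permutation′ n → Set

-- Permutations act on the right: (π ∘ₚ ρ) ⟨$⟩ʳ i = ρ ⟨$⟩ʳ (π ⟨$⟩ʳ i),
-- so  π ∘ₚ ρ  is the product "π ρ" in the right-action convention.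

record IsPermGroup {n : ℕ} (G : PermSet n) : Set where
  field
    resp  : ∀ {π ρ} → π ≈ ρ → G π → G ρ
    id∈   : G id
    ∘∈    : ∀ {π ρ} → G π → G ρ → G (π ∘ₚ ρ)
    inv∈  : ∀ {π} → G π → G (flip π)

record IsSubgroup {n : ℕ} (N G : PermSet n) : Set where
  field
    isGroup : IsPermGroup N
    ⊆G      : ∀ {π} → N π → G π

record IsNormalSubgroup {n : ℕ} (N G : PermSet n) : Set where
  field
    isSubgroup : IsSubgroup N G
    conj∈      : ∀ {g x} → G g → N x → N (flip g ∘ₚ x ∘ₚ g)

IsTwoTransitive : {n : ℕ} → PermSet n → Set
IsTwoTransitive {n} G =
  ∀ (a b c d : Fin n) → a ≢ b → c ≢ d →
  Σ (Permutation′ n) λ g → G g × (g ⟨$⟩ʳ a ≡ c) × (g ⟨$⟩ʳ b ≡ d)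

IsRegular : {n : ℕ} → PermSet n → Set
IsRegular {n} N =
  (∀ (a b : Fin n) → Σ (Permutation′ n) λ x → N x × (x ⟨$⟩ʳ a ≡ b))
  × (∀ x → N x → ∀ (a : Fin n) → x ⟨$⟩ʳ a ≡ a → x ≈ id)

Stabilizer : {n : ℕ} → PermSet n → Fin n → PermSet n
Stabilizer G α g = G g × (g ⟨$⟩ʳ α ≡ α)

IsDerangement : {n : ℕ} → Permutation′ n → Set
IsDerangement {n} g = ∀ (i : Fin n) → g ⟨$⟩ʳ i ≢ i

InCoset : {n : ℕ} → PermSet n → Permutation′ n → PermSet n
InCoset N h g = Σ _ λ x → N x × (g ≈ (x ∘ₚ h))

CosetHasDerangement : {n : ℕ} → PermSet n → Permutation′ n → Set
CosetHasDerangement N h = Σ _ λ g → InCoset N h g × IsDerangement g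

CentralizesNontrivialOf : {n : ℕ} → PermSet n → Permutation′ n → Set
CentralizesNontrivialOf N h =
  Σ _ λ x → N x × ¬ (x ≈ id) × ((h ∘ₚ x) ≈ (x ∘ₚ h))

module Submission where

-- Let N be a regular normal subgroup of a permutation group G on Ω = Fin n,
-- and let h ∈ G fix the point α.  For δ ∈ Ω let c δ be the unique element of
-- N carrying α to δ, and put
--     ψ δ = c δ⁻¹ · h · c δ · h⁻¹ ∈ N      (products read left to right),
-- the unique element of N sending δ to h⁻¹ δ.  For y ∈ N the permutation y h
-- fixes β exactly when y = ψ β, i.e. when y α = Ψ β, where Ψ β = ψ β α.
-- Hence y h is a derangement iff the value y α is missed by Ψ : Ω → Ω, and
-- since every value of Ω is y α for some y ∈ N, the coset N h contains a
-- derangement iff Ψ is not surjective.  For an endomap of a finite set this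
-- is equivalent to Ψ identifying two distinct points.  Finally Ψ δ₁ = Ψ δ₂
-- says that c δ₁ and c δ₂ conjugate h to the same element, i.e. that h
-- centralizes c δ₂ c δ₁⁻¹, which is nontrivial iff δ₁ ≠ δ₂.

open import Defs
open import Data.Nat using (ℕ; suc)
open import Data.Nat.Properties using (n<1+n)
open import Data.Fin using (Fin; punchOut; _≟_)
open import Data.Fin.Properties using (pigeonhole; punchOut-injective; any?; all?; ¬∀⟶∃¬; <⇒≢)
open import Data.Fin.Permutation using (Permutation′; _⟨$⟩ʳ_; _⟨$⟩ˡ_; _≈_; id; flip; _∘ₚ_; inverseˡ; inverseʳ)
open import Data.Product using (_×_; ∃; ∃₂; _,_; proj₁; proj₂)
open import Data.Empty using (⊥-elim)
open import Function using (_∘_)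
open import Function.Definitions using (Injective)
open import Relation.Nullary using (¬_; yes; no)
open import Relation.Binary.PropositionalEquality using (_≡_; _≢_; refl; sym; trans; cong; module ≡-Reasoning)

missesValue⇒collision : ∀ {n} (f : Fin n → Fin n) (γ : Fin n) → (∀ δ → f δ ≢ γ) →
  ∃₂ λ i j → i ≢ j × f i ≡ f j
missesValue⇒collision {suc m} f γ miss
  with i , j , i<j , eq ← pigeonhole (n<1+n m) (λ δ → punchOut (miss δ ∘ sym))
  = i , j , <⇒≢ i<j , punchOut-injective (miss i ∘ sym) (miss j ∘ sym) eq

injective⇒surjective : ∀ {n} (f : Fin n → Fin n) → Injective _≡_ _≡_ f →
  ∀ γ → ∃ λ δ → f δ ≡ γ
injective⇒surjective f inj γ with any? (λ δ → f δ ≟ γ)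
... | yes hit = hit
... | no ¬hit with i , j , i≢j , eq ← missesValue⇒collision f γ (λ δ e → ¬hit (δ , e))
  = ⊥-elim (i≢j (inj eq))

-- An endomap of Fin n identifying two distinct points misses some value.
-- Surjectivity is decidable; a surjective f has an injective, hence
-- surjective, section, which makes f injective.
collision⇒missesValue : ∀ {n} (f : Fin n → Fin n) {i j} → i ≢ j → f i ≡ f j →
  ∃ λ γ → ∀ δ → f δ ≢ γ
collision⇒missesValue {n} f {i} {j} i≢j fi≡fj with all? (λ γ → any? (λ δ → f δ ≟ γ))
... | no ¬surj with γ , ¬hit ← ¬∀⟶∃¬ n _ (λ γ → any? (λ δ → f δ ≟ γ)) ¬surj
  = γ , λ δ e → ¬hit (δ , e)
... | yes surj = ⊥-elim (i≢j i≡j)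
  where
  section : Fin n → Fin n
  section γ = proj₁ (surj γ)

  f∘section : ∀ γ → f (section γ) ≡ γ
  f∘section γ = proj₂ (surj γ)

  section-injective : Injective _≡_ _≡_ section
  section-injective {γ} {γ′} e = trans (sym (f∘section γ)) (trans (cong f e) (f∘section γ′))

  -- section is surjective, hence a two-sided inverse of f
  section∘f : ∀ k → section (f k) ≡ k
  section∘f k with γ , sγ≡k ← injective⇒surjective section section-injective k =
    trans (cong section (trans (cong f (sym sγ≡k)) (f∘section γ))) sγ≡k

  i≡j : i ≡ j
  i≡j = trans (sym (section∘f i)) (trans (cong section fi≡fj) (section∘f j))

conjugates-equal⇒commute : ∀ {n} (h c₁ c₂ : Permutation′ n) →
  (flip c₁ ∘ₚ h ∘ₚ c₁) ≈ (flip c₂ ∘ₚ h ∘ₚ c₂) →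
  (h ∘ₚ c₂ ∘ₚ flip c₁) ≈ ((c₂ ∘ₚ flip c₁) ∘ₚ h)
conjugates-equal⇒commute h c₁ c₂ eq i = begin
  c₁ ⟨$⟩ˡ (c₂ ⟨$⟩ʳ (h ⟨$⟩ʳ i))
    ≡⟨ cong (λ k → c₁ ⟨$⟩ˡ (c₂ ⟨$⟩ʳ (h ⟨$⟩ʳ k))) (sym (inverseˡ c₂)) ⟩
  c₁ ⟨$⟩ˡ (c₂ ⟨$⟩ʳ (h ⟨$⟩ʳ (c₂ ⟨$⟩ˡ (c₂ ⟨$⟩ʳ i))))
    ≡⟨ cong (c₁ ⟨$⟩ˡ_) (sym (eq (c₂ ⟨$⟩ʳ i))) ⟩
  c₁ ⟨$⟩ˡ (c₁ ⟨$⟩ʳ (h ⟨$⟩ʳ (c₁ ⟨$⟩ˡ (c₂ ⟨$⟩ʳ i))))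
    ≡⟨ inverseˡ c₁ ⟩
  h ⟨$⟩ʳ (c₁ ⟨$⟩ˡ (c₂ ⟨$⟩ʳ i)) ∎
  where open ≡-Reasoning

module Semiregular {n : ℕ} {N : PermSet n} (N-group : IsPermGroup N)
  (semiregular : ∀ x → N x → ∀ (a : Fin n) → x ⟨$⟩ʳ a ≡ a → x ≈ id) where
  open IsPermGroup N-group

  agree-at⇒≈ : ∀ {x z} → N x → N z → ∀ a → x ⟨$⟩ʳ a ≡ z ⟨$⟩ʳ a → x ≈ z
  agree-at⇒≈ {x} {z} Nx Nz a e i = begin
    x ⟨$⟩ʳ i                           ≡⟨ sym (inverseʳ z) ⟩
    z ⟨$⟩ʳ (z ⟨$⟩ˡ (x ⟨$⟩ʳ i))        ≡⟨ cong (z ⟨$⟩ʳ_) (semiregular _ (∘∈ Nx (inv∈ Nz)) a xz⁻¹-fixes-a i) ⟩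
    z ⟨$⟩ʳ i                           ∎
    where
    open ≡-Reasoning
    xz⁻¹-fixes-a : z ⟨$⟩ˡ (x ⟨$⟩ʳ a) ≡ a
    xz⁻¹-fixes-a = trans (cong (z ⟨$⟩ˡ_) e) (inverseˡ z)

module RegularNormal {n : ℕ} {G N : PermSet n} (G-group : IsPermGroup G)
  (N-normal : IsNormalSubgroup N G) (N-regular : IsRegular N)
  (α : Fin n) (h : Permutation′ n) (h∈G : G h) (hα≡α : h ⟨$⟩ʳ α ≡ α) where
  open IsNormalSubgroup N-normal
  open IsSubgroup isSubgroup renaming (isGroup to N-group)
  open IsPermGroup N-group
  open Semiregular N-group (proj₂ N-regular)

  carry : Fin n → Permutation′ n
  carry δ = proj₁ (proj₁ N-regular α δ)

  carry∈N : ∀ δ → N (carry δ)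
  carry∈N δ = proj₁ (proj₂ (proj₁ N-regular α δ))

  carry-α : ∀ δ → carry δ ⟨$⟩ʳ α ≡ δ
  carry-α δ = proj₂ (proj₂ (proj₁ N-regular α δ))

  ψ : Fin n → Permutation′ n
  ψ δ = (flip (carry δ) ∘ₚ h ∘ₚ carry δ) ∘ₚ flip h

  ψ∈N : ∀ δ → N (ψ δ)
  ψ∈N δ = resp (λ _ → refl)
    (∘∈ (inv∈ (carry∈N δ)) (conj∈ (IsPermGroup.inv∈ G-group h∈G) (carry∈N δ)))

  ψ-at-δ : ∀ δ → ψ δ ⟨$⟩ʳ δ ≡ h ⟨$⟩ˡ δ
  ψ-at-δ δ = cong (h ⟨$⟩ˡ_) (begin
    carry δ ⟨$⟩ʳ (h ⟨$⟩ʳ (carry δ ⟨$⟩ˡ δ))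
      ≡⟨ cong (λ k → carry δ ⟨$⟩ʳ (h ⟨$⟩ʳ (carry δ ⟨$⟩ˡ k))) (sym (carry-α δ)) ⟩
    carry δ ⟨$⟩ʳ (h ⟨$⟩ʳ (carry δ ⟨$⟩ˡ (carry δ ⟨$⟩ʳ α)))
      ≡⟨ cong (λ k → carry δ ⟨$⟩ʳ (h ⟨$⟩ʳ k)) (inverseˡ (carry δ)) ⟩
    carry δ ⟨$⟩ʳ (h ⟨$⟩ʳ α)
      ≡⟨ cong (carry δ ⟨$⟩ʳ_) hα≡α ⟩
    carry δ ⟨$⟩ʳ α
      ≡⟨ carry-α δ ⟩
    δ ∎)
    where open ≡-Reasoning

  -- The map whose missed values are exactly the α-images of the y ∈ N for
  -- which y h is a derangement.
  Ψ : Fin n → Fin n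
  Ψ δ = ψ δ ⟨$⟩ʳ α

  fixes⇒Ψ : ∀ {y} → N y → ∀ β → (y ∘ₚ h) ⟨$⟩ʳ β ≡ β → y ⟨$⟩ʳ α ≡ Ψ β
  fixes⇒Ψ {y} y∈N β yhβ≡β = agree-at⇒≈ y∈N (ψ∈N β) β yβ≡ψβ α
    where
    yβ≡ψβ : y ⟨$⟩ʳ β ≡ ψ β ⟨$⟩ʳ β
    yβ≡ψβ = trans (trans (sym (inverseˡ h)) (cong (h ⟨$⟩ˡ_) yhβ≡β)) (sym (ψ-at-δ β))

  Ψ⇒fixes : ∀ {y} → N y → ∀ β → y ⟨$⟩ʳ α ≡ Ψ β → (y ∘ₚ h) ⟨$⟩ʳ β ≡ β
  Ψ⇒fixes {y} y∈N β yα≡Ψβ = begin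
    h ⟨$⟩ʳ (y ⟨$⟩ʳ β)       ≡⟨ cong (h ⟨$⟩ʳ_) (agree-at⇒≈ y∈N (ψ∈N β) α yα≡Ψβ β) ⟩
    h ⟨$⟩ʳ (ψ β ⟨$⟩ʳ β)     ≡⟨ cong (h ⟨$⟩ʳ_) (ψ-at-δ β) ⟩
    h ⟨$⟩ʳ (h ⟨$⟩ˡ β)       ≡⟨ inverseʳ h ⟩
    β                        ∎
    where open ≡-Reasoning

  Ψ-at-fixed-point : ∀ β → h ⟨$⟩ʳ β ≡ β → Ψ β ≡ α
  Ψ-at-fixed-point β hβ≡β = sym (fixes⇒Ψ id∈ β hβ≡β)

  collision⇒centralizes : ∀ {δ₁ δ₂} → δ₁ ≢ δ₂ → Ψ δ₁ ≡ Ψ δ₂ → CentralizesNontrivialOf N h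
  collision⇒centralizes {δ₁} {δ₂} δ₁≢δ₂ Ψδ₁≡Ψδ₂ =
    d , ∘∈ (carry∈N δ₂) (inv∈ (carry∈N δ₁)) , d≉id ,
    conjugates-equal⇒commute h (carry δ₁) (carry δ₂) conjugates-equal
    where
    d : Permutation′ n
    d = carry δ₂ ∘ₚ flip (carry δ₁)

    ψ-equal : ψ δ₁ ≈ ψ δ₂
    ψ-equal = agree-at⇒≈ (ψ∈N δ₁) (ψ∈N δ₂) α Ψδ₁≡Ψδ₂

    -- ψ δ = (h conjugated by carry δ) h⁻¹, so equal ψ's give equal conjugates.
    conjugates-equal : (flip (carry δ₁) ∘ₚ h ∘ₚ carry δ₁) ≈ (flip (carry δ₂) ∘ₚ h ∘ₚ carry δ₂)
    conjugates-equal j = trans (sym (inverseʳ h)) (trans (cong (h ⟨$⟩ʳ_) (ψ-equal j)) (inverseʳ h))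

    d≉id : ¬ (d ≈ id)
    d≉id d≈id = δ₁≢δ₂ (begin
      δ₁                                        ≡⟨ sym (carry-α δ₁) ⟩
      carry δ₁ ⟨$⟩ʳ α                           ≡⟨ cong (carry δ₁ ⟨$⟩ʳ_) (sym (d≈id α)) ⟩
      carry δ₁ ⟨$⟩ʳ (d ⟨$⟩ʳ α)                 ≡⟨ inverseʳ (carry δ₁) ⟩
      carry δ₂ ⟨$⟩ʳ α                           ≡⟨ carry-α δ₂ ⟩
      δ₂                                        ∎)
      where open ≡-Reasoning

  -- A nontrivial d ∈ N centralized by h moves α to another fixed point of h,
  -- so Ψ identifies α and d α.
  centralizes⇒collision : CentralizesNontrivialOf N h → ∃₂ λ δ₁ δ₂ → δ₁ ≢ δ₂ × Ψ δ₁ ≡ Ψ δ₂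
  centralizes⇒collision (d , d∈N , d≉id , hd≈dh) =
    α , d ⟨$⟩ʳ α , α≢dα ,
    trans (Ψ-at-fixed-point α hα≡α) (sym (Ψ-at-fixed-point (d ⟨$⟩ʳ α) h-fixes-dα))
    where
    α≢dα : α ≢ d ⟨$⟩ʳ α
    α≢dα α≡dα = d≉id (proj₂ N-regular d d∈N α (sym α≡dα))

    h-fixes-dα : h ⟨$⟩ʳ (d ⟨$⟩ʳ α) ≡ d ⟨$⟩ʳ α
    h-fixes-dα = trans (sym (hd≈dh α)) (cong (d ⟨$⟩ʳ_) hα≡α)

lemma5p4 : (n : ℕ) (G N : PermSet n) (α : Fin n) →
    IsPermGroup G → IsTwoTransitive G →
    IsNormalSubgroup N G → IsRegular N →
    (h : Permutation′ n) → Stabilizer G α h →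
    (CosetHasDerangement N h → CentralizesNontrivialOf N h)
    × (CentralizesNontrivialOf N h → CosetHasDerangement N h)
lemma5p4 n G N α G-group _ N-normal N-regular h (h∈G , hα≡α) = forward , backward
  where
  open RegularNormal G-group N-normal N-regular α h h∈G hα≡α

  -- A derangement y h in N h means Ψ misses y α, so Ψ has a collision.
  forward : CosetHasDerangement N h → CentralizesNontrivialOf N h
  forward (g , (y , y∈N , g≈yh) , g-deranges)
    with i , j , i≢j , Ψi≡Ψj ← missesValue⇒collision Ψ (y ⟨$⟩ʳ α)
           (λ β Ψβ≡yα → g-deranges β (trans (g≈yh β) (Ψ⇒fixes y∈N β (sym Ψβ≡yα))))
    = collision⇒centralizes i≢j Ψi≡Ψj

  -- A collision of Ψ gives a missed value γ; with y = carry γ, y h deranges.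
  backward : CentralizesNontrivialOf N h → CosetHasDerangement N h
  backward centralizes
    with i , j , i≢j , Ψi≡Ψj ← centralizes⇒collision centralizes
    with γ , Ψ-misses-γ ← collision⇒missesValue Ψ i≢j Ψi≡Ψj
    = carry γ ∘ₚ h , (carry γ , carry∈N γ , λ _ → refl) ,
      λ β yhβ≡β → Ψ-misses-γ β (trans (sym (fixes⇒Ψ (carry∈N γ) β yhβ≡β)) (carry-α γ))
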